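{- Let $\mathbf A$ be a Girard semilattice satisfying $x\le((x\to y)\wedge 1)\to y$ for all $x,y$. Then $D(\mathbf A)$ is closed under $\circ$, and $\langle D(\mathbf A),\circ,\mathbf 1\rangle$ is a commutative monoid.
   Context: A (pointed) Girard semilattice is an algebra $\langle A,\to,\wedge,1\rangle$ such that $\langle A,\wedge,1\rangle$ is a meet-semilattice with a constant $1$ (with $\le$ the semilattice order) and for all $a,b,c\in A$: (L1) $1\to a=a$; (L2) $a\to a\ge 1$; (L3) $(a\to b)\wedge(a\to c)=a\to(b\wedge c)$; (L4) $a\to b\le (c\to a)\to(c\to b)$; (L5) $a\to(b\to c)\le b\to(a\to c)$; (L6) if $a\to b\ge 1$ and $b\to a\ge 1$ then $a=b$. Let $\Gamma_{\mathbf A}$ be the set of semilattice filters of $\mathbf A$ (nonempty up-closed subsets closed under $\wedge$). A set $X\subseteq\Gamma_{\mathbf A}$ is hereditary if $F\in X$ and $F\subseteq G\in\Gamma_{\mathbf A}$ imply $G\in X$; $D(\mathbf A)$ is the set of hereditary subsets of $\Gamma_{\mathbf A}$. For $a\in A$ put $\mathbf a=\{F\in\Gamma_{\mathbf A}: a\in F\}$; in particular $\mathbf 1=\{F\in\Gamma_{\mathbf A}:1\in F\}$. Define a ternary relation $R$ on $\Gamma_{\mathbf A}$ by: $R(F,G,H)$ iff for all $a,b\in A$, $a\in F$ and $a\to b\in G$ imply $b\in H$. For $X,Y\in D(\mathbf A)$ let $X\circ Y=\{H\in\Gamma_{\mathbf A}:\exists F\in Y,\ \exists G\in X \text{ with }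 R(F,G,H)\}$. -}

module Defs where

open import Level using (Level; 0ℓ; suc)
open import Data.Product using (Σ; ∃; _×_; _,_; proj₁; proj₂)
open import Relation.Binary.PropositionalEquality using (_≡_)
open import Algebra.Structures using (IsCommutativeMonoid)

record GirardSemilattice : Set₁ where
  infixr 5 _⇒_
  infixr 6 _∧_
  field
    Carrier : Set
    _⇒_     : Carrier → Carrier → Carrier
    _∧_     : Carrier → Carrier → Carrier
    one     : Carrier
    ∧-assoc : ∀ a b c → (a ∧ b) ∧ c ≡ a ∧ (b ∧ c)
    ∧-comm  : ∀ a b → a ∧ b ≡ b ∧ a
    ∧-idem  : ∀ a → a ∧ a ≡ a

  _≤_ : Carrier → Carrier → Set
  a ≤ b = a ∧ b ≡ a

  field
    L1 : ∀ a → one ⇒ a ≡ a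
    L2 : ∀ a → one ≤ (a ⇒ a)
    L3 : ∀ a b c → (a ⇒ b) ∧ (a ⇒ c) ≡ a ⇒ (b ∧ c)
    L4 : ∀ a b c → (a ⇒ b) ≤ ((c ⇒ a) ⇒ (c ⇒ b))
    L5 : ∀ a b c → (a ⇒ (b ⇒ c)) ≤ (b ⇒ (a ⇒ c))
    L6 : ∀ a b → one ≤ (a ⇒ b) → one ≤ (b ⇒ a) → a ≡ b

module _ (𝐀 : GirardSemilattice) where
  open GirardSemilattice 𝐀

  record IsFilter (F : Carrier → Set) : Set where
    field
      nonempty : ∃ F
      upClosed : ∀ {a b} → F a → a ≤ b → F b
      ∧-closed : ∀ {a b} → F a → F b → F (a ∧ b)

  Filter : Set₁
  Filter = Σ (Carrier → Set) IsFilter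

  _⊆F_ : Filter → Filter → Set
  F ⊆F G = ∀ a → proj₁ F a → proj₁ G a

  FSet : Set₂
  FSet = Filter → Set₁

  Hereditary : FSet → Set₁
  Hereditary X = ∀ F G → X F → F ⊆F G → X G

  D : Set₂
  D = Σ FSet Hereditary

  _≐_ : D → D → Set₁
  X ≐ Y = ∀ F → (proj₁ X F → proj₁ Y F) × (proj₁ Y F → proj₁ X F)

  ⟦_⟧ : Carrier → FSet
  ⟦ a ⟧ F = Level.Lift (suc 0ℓ) (proj₁ F a)

  R : Filter → Filter → Filter → Set
  R F G H = ∀ a b → proj₁ F a → proj₁ G (a ⇒ b) → proj₁ H b

  _∘_ : FSet → FSet → FSet
  (X ∘ Y) H = Σ Filter λ F → Σ Filter λ G → Y F × X G × R F G H

  Hyp : Set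
  Hyp = ∀ x y → x ≤ (((x ⇒ y) ∧ one) ⇒ y)

{-# OPTIONS --safe #-}
module Submission where

-- The hypothesis yields x ≤ (x → y) → y, which makes R symmetric in its first two arguments,
-- hence ∘ commutative.  Given R(F', G', G) and R(F, G, H), the filter
-- F·F' = {b : ∃ a ∈ F, a → b ∈ F'} satisfies R(F, F', F·F') and R(F·F', G', H), so one
-- inclusion of associativity holds; commutativity turns it into the other one.  Finally
-- 1 ∘ X = X: one inclusion because G ∋ 1 forces a → a ∈ G, the other via the filter ↑1.

open import Defs
open import Level using (lift; lower)
open import Data.Product using (Σ; _,_; proj₁; proj₂; _×_)
open import Relation.Binary.PropositionalEquality using (_≡_; sym; trans; cong; subst)
open import Relation.Binary.Structures using (IsEquivalence)
open import Algebra.Structures using (IsCommutativeMonoid)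
import Algebra.Structures.Biased as Biased

module Order (𝐀 : GirardSemilattice) where
  open GirardSemilattice 𝐀

  ≤-trans : ∀ {a b c} → a ≤ b → b ≤ c → a ≤ c
  ≤-trans {a} {b} {c} a≤b b≤c =
    trans (cong (_∧ c) (sym a≤b)) (trans (∧-assoc a b c) (trans (cong (a ∧_) b≤c) a≤b))

  x∧y≤x : ∀ x y → (x ∧ y) ≤ x
  x∧y≤x x y = trans (∧-assoc x y x) (trans (cong (x ∧_) (∧-comm y x))
                (trans (sym (∧-assoc x x y)) (cong (_∧ y) (∧-idem x))))

  x∧y≤y : ∀ x y → (x ∧ y) ≤ y
  x∧y≤y x y = trans (∧-assoc x y y) (cong (x ∧_) (∧-idem y))

  ∧-greatest : ∀ {a b c} → c ≤ a → c ≤ b → c ≤ (a ∧ b)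
  ∧-greatest {a} {b} {c} c≤a c≤b = trans (sym (∧-assoc c a b)) (trans (cong (_∧ b) c≤a) c≤b)

  ⇒-monoʳ-≤ : ∀ {a b c} → b ≤ c → (a ⇒ b) ≤ (a ⇒ c)
  ⇒-monoʳ-≤ {a} {b} {c} b≤c = trans (L3 a b c) (cong (a ⇒_) b≤c)

  ≤⇒one≤⇒ : ∀ {a b} → a ≤ b → one ≤ (a ⇒ b)
  ≤⇒one≤⇒ {a} {b} a≤b = ≤-trans (L2 a) (subst (λ t → (a ⇒ t) ≤ (a ⇒ b)) a≤b (⇒-monoʳ-≤ (x∧y≤y a b)))

  one≤⇒⇒≤ : ∀ {a b} → one ≤ (a ⇒ b) → a ≤ b
  one≤⇒⇒≤ {a} {b} one≤a⇒b = sym (L6 a (a ∧ b) one≤a⇒a∧b (≤⇒one≤⇒ (x∧y≤x a b)))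
    where
    one≤a⇒a∧b : one ≤ (a ⇒ (a ∧ b))
    one≤a⇒a∧b = subst (one ≤_) (L3 a a b) (∧-greatest (L2 a) one≤a⇒b)

  ⇒-antimonoˡ-≤ : ∀ {a b c} → c ≤ a → (a ⇒ b) ≤ (c ⇒ b)
  ⇒-antimonoˡ-≤ {a} {b} {c} c≤a = one≤⇒⇒≤ (≤-trans (≤⇒one≤⇒ c≤a) (one≤⇒⇒≤ prefixing))
    where
    prefixing : one ≤ ((c ⇒ a) ⇒ ((a ⇒ b) ⇒ (c ⇒ b)))
    prefixing = ≤-trans (≤⇒one≤⇒ (L4 a b c)) (L5 (a ⇒ b) (c ⇒ a) (c ⇒ b))

  x≤[x⇒y]⇒y : Hyp 𝐀 → ∀ x y → x ≤ ((x ⇒ y) ⇒ y)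
  x≤[x⇒y]⇒y hyp x y = subst (x ≤_) drop-one (hyp x ((x ⇒ y) ⇒ y))
    where
    one≤x⇒[x⇒y]⇒y : one ≤ (x ⇒ ((x ⇒ y) ⇒ y))
    one≤x⇒[x⇒y]⇒y = ≤-trans (L2 (x ⇒ y)) (L5 (x ⇒ y) x y)
    drop-one : ((x ⇒ ((x ⇒ y) ⇒ y)) ∧ one) ⇒ ((x ⇒ y) ⇒ y) ≡ (x ⇒ y) ⇒ y
    drop-one = trans (cong (_⇒ ((x ⇒ y) ⇒ y)) (trans (∧-comm _ one) one≤x⇒[x⇒y]⇒y)) (L1 _)

module FilterFrame (𝐀 : GirardSemilattice) (hyp : Hyp 𝐀) where
  open GirardSemilattice 𝐀
  open Order 𝐀
  open IsFilter

  infixl 7 _⊙_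
  _⊙_ : FSet 𝐀 → FSet 𝐀 → FSet 𝐀
  _⊙_ = _∘_ 𝐀

  𝟏 : FSet 𝐀
  𝟏 = ⟦_⟧ 𝐀 one

  ∘-hereditary : (X Y : D 𝐀) → Hereditary 𝐀 (proj₁ X ⊙ proj₁ Y)
  ∘-hereditary X Y H H' (F , G , F∈Y , G∈X , R[F,G,H]) H⊆H' =
    F , G , F∈Y , G∈X , λ a b a∈F a⇒b∈G → H⊆H' b (R[F,G,H] a b a∈F a⇒b∈G)

  ∘ᴰ : D 𝐀 → D 𝐀 → D 𝐀
  ∘ᴰ X Y = proj₁ X ⊙ proj₁ Y , ∘-hereditary X Y

  𝟏-hereditary : Hereditary 𝐀 𝟏
  𝟏-hereditary F G 1∈F F⊆G = lift (F⊆G one (lower 1∈F))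

  ↑one : Filter 𝐀
  ↑one = (one ≤_) , record
    { nonempty = one , ∧-idem one
    ; upClosed = ≤-trans
    ; ∧-closed = ∧-greatest
    }

  _·_ : Filter 𝐀 → Filter 𝐀 → Filter 𝐀
  F · G = (λ b → Σ Carrier λ a → proj₁ F a × proj₁ G (a ⇒ b)) , isFilter
    where
    isFilter : IsFilter 𝐀 _
    isFilter .nonempty with nonempty (proj₂ F) | nonempty (proj₂ G)
    ... | a , a∈F | c , c∈G =
      ((c ⇒ (a ⇒ a)) ⇒ a) , a , a∈F ,
      upClosed (proj₂ G) c∈G (≤-trans (x≤[x⇒y]⇒y hyp c (a ⇒ a)) (L5 (c ⇒ (a ⇒ a)) a a))
    isFilter .upClosed (a , a∈F , a⇒b∈G) b≤b' = a , a∈F , upClosed (proj₂ G) a⇒b∈G (⇒-monoʳ-≤ b≤b')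
    isFilter .∧-closed {b} {b'} (a , a∈F , a⇒b∈G) (a' , a'∈F , a'⇒b'∈G) =
      (a ∧ a') , ∧-closed (proj₂ F) a∈F a'∈F ,
      subst (proj₁ G) (L3 (a ∧ a') b b')
        (∧-closed (proj₂ G) (upClosed (proj₂ G) a⇒b∈G (⇒-antimonoˡ-≤ (x∧y≤x a a')))
                            (upClosed (proj₂ G) a'⇒b'∈G (⇒-antimonoˡ-≤ (x∧y≤y a a'))))

  R-product : (F G : Filter 𝐀) → R 𝐀 F G (F · G)
  R-product F G a b a∈F a⇒b∈G = a , a∈F , a⇒b∈G

  R-sym : ∀ {F G H} → R 𝐀 F G H → R 𝐀 G F H
  R-sym {G = G} R[F,G,H] a b a∈G a⇒b∈F =
    R[F,G,H] (a ⇒ b) b a⇒b∈F (upClosed (proj₂ G) a∈G (x≤[x⇒y]⇒y hyp a b))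

  R-assoc : ∀ {F F' G' G H} →
            R 𝐀 F' G' G → R 𝐀 F G H → R 𝐀 (F · F') G' H
  R-assoc {F} {F'} {G'} R[F',G',G] R[F,G,H] b c (a , a∈F , a⇒b∈F') b⇒c∈G' =
    R[F,G,H] a c a∈F (R[F',G',G] (a ⇒ b) (a ⇒ c) a⇒b∈F' (upClosed (proj₂ G') b⇒c∈G' (L4 b c a)))

  R-identity : ∀ {F G H} → proj₁ G one → R 𝐀 F G H → _⊆F_ 𝐀 F H
  R-identity {G = G} 1∈G R[F,G,H] a a∈F = R[F,G,H] a a a∈F (upClosed (proj₂ G) 1∈G (L2 a))

  R-↑one : ∀ H → R 𝐀 H ↑one H
  R-↑one H a b a∈H one≤a⇒b = upClosed (proj₂ H) a∈H (one≤⇒⇒≤ one≤a⇒b)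

  infix 4 _⊆_
  _⊆_ : FSet 𝐀 → FSet 𝐀 → Set₁
  X ⊆ Y = ∀ F → X F → Y F

  ⊆-trans : ∀ {X Y Z} → X ⊆ Y → Y ⊆ Z → X ⊆ Z
  ⊆-trans X⊆Y Y⊆Z F F∈X = Y⊆Z F (X⊆Y F F∈X)

  ⊆-refl : ∀ {X} → X ⊆ X
  ⊆-refl F F∈X = F∈X

  ∘-mono : ∀ {X X' Y Y'} → X ⊆ X' → Y ⊆ Y' → X ⊙ Y ⊆ X' ⊙ Y'
  ∘-mono X⊆X' Y⊆Y' H (F , G , F∈Y , G∈X , R[F,G,H]) = F , G , Y⊆Y' F F∈Y , X⊆X' G G∈X , R[F,G,H]

  ∘-comm-⊆ : ∀ X Y → X ⊙ Y ⊆ Y ⊙ X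
  ∘-comm-⊆ X Y H (F , G , F∈Y , G∈X , R[F,G,H]) = G , F , G∈X , F∈Y , R-sym {F} {G} {H} R[F,G,H]

  ∘-assoc-⊆ : ∀ X Y Z → X ⊙ Y ⊙ Z ⊆ X ⊙ (Y ⊙ Z)
  ∘-assoc-⊆ X Y Z H (F , G , F∈Z , (F' , G' , F'∈Y , G'∈X , R[F',G',G]) , R[F,G,H]) =
    F · F' , G' , (F , F' , F∈Z , F'∈Y , R-product F F') , G'∈X ,
    R-assoc {F} {F'} {G'} {G} {H} R[F',G',G] R[F,G,H]

  ∘-assoc-⊇ : ∀ X Y Z → X ⊙ (Y ⊙ Z) ⊆ X ⊙ Y ⊙ Z
  ∘-assoc-⊇ X Y Z =
    ⊆-trans (∘-comm-⊆ X (Y ⊙ Z)) (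
    ⊆-trans (∘-mono {Y = X} (∘-comm-⊆ Y Z) ⊆-refl) (
    ⊆-trans (∘-assoc-⊆ Z Y X) (
    ⊆-trans (∘-mono {X = Z} ⊆-refl (∘-comm-⊆ Y X))
            (∘-comm-⊆ Z (X ⊙ Y)))))

  𝟏∘X⊆X : ∀ (X : D 𝐀) → 𝟏 ⊙ proj₁ X ⊆ proj₁ X
  𝟏∘X⊆X X H (F , G , F∈X , 1∈G , R[F,G,H]) = proj₂ X F H F∈X (R-identity {F} {G} {H} (lower 1∈G) R[F,G,H])

  X⊆𝟏∘X : ∀ X → X ⊆ 𝟏 ⊙ X
  X⊆𝟏∘X X H H∈X = H , ↑one , H∈X , lift (∧-idem one) , R-↑one H

  ≐-intro : ∀ {X Y : D 𝐀} → proj₁ X ⊆ proj₁ Y → proj₁ Y ⊆ proj₁ X → _≐_ 𝐀 X Y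
  ≐-intro X⊆Y Y⊆X F = X⊆Y F , Y⊆X F

  ≐-isEquivalence : IsEquivalence (_≐_ 𝐀)
  ≐-isEquivalence = record
    { refl  = λ {X} → ≐-intro {X} {X} ⊆-refl ⊆-refl
    ; sym   = λ X≐Y F → proj₂ (X≐Y F) , proj₁ (X≐Y F)
    ; trans = λ X≐Y Y≐Z F → ⊆-trans (λ F → proj₁ (X≐Y F)) (λ F → proj₁ (Y≐Z F)) F
                            , ⊆-trans (λ F → proj₂ (Y≐Z F)) (λ F → proj₂ (X≐Y F)) F
    }

mainTheorem4 : (𝐀 : GirardSemilattice) → Hyp 𝐀 →
    Σ ((X Y : D 𝐀) → Hereditary 𝐀 (_∘_ 𝐀 (proj₁ X) (proj₁ Y))) λ closed →
      Σ (Hereditary 𝐀 (⟦_⟧ 𝐀 (GirardSemilattice.one 𝐀))) λ oneHer →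
        IsCommutativeMonoid (_≐_ 𝐀)
          (λ X Y → (_∘_ 𝐀 (proj₁ X) (proj₁ Y) , closed X Y))
          (⟦_⟧ 𝐀 (GirardSemilattice.one 𝐀) , oneHer)
mainTheorem4 𝐀 hyp = ∘-hereditary , 𝟏-hereditary , isCommutativeMonoidˡ record
  { isSemigroup = record
    { isMagma = record
      { isEquivalence = ≐-isEquivalence
      ; ∙-cong = λ {X} {X'} {Y} {Y'} X≐X' Y≐Y' →
          ≐-intro {∘ᴰ X Y} {∘ᴰ X' Y'} (∘-mono (λ F → proj₁ (X≐X' F)) (λ F → proj₁ (Y≐Y' F)))
                                      (∘-mono (λ F → proj₂ (X≐X' F)) (λ F → proj₂ (Y≐Y' F)))
      }
    ; assoc = λ X Y Z → ≐-intro {∘ᴰ (∘ᴰ X Y) Z} {∘ᴰ X (∘ᴰ Y Z)}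
        (∘-assoc-⊆ (proj₁ X) (proj₁ Y) (proj₁ Z)) (∘-assoc-⊇ (proj₁ X) (proj₁ Y) (proj₁ Z))
    }
  ; identityˡ = λ X → ≐-intro {∘ᴰ (𝟏 , 𝟏-hereditary) X} {X} (𝟏∘X⊆X X) (X⊆𝟏∘X (proj₁ X))
  ; comm = λ X Y → ≐-intro {∘ᴰ X Y} {∘ᴰ Y X}
      (∘-comm-⊆ (proj₁ X) (proj₁ Y)) (∘-comm-⊆ (proj₁ Y) (proj₁ X))
  }
  where
  open FilterFrame 𝐀 hyp
  open Biased (_≐_ 𝐀) using (isCommutativeMonoidˡ)
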